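{- For every $t\in[n]$, conditioned on $\mathbf B_t$, the permutation $\boldsymbol\pi$ is uniformly distributed on $$\boldsymbol\Pi_t=\left\{\pi\in S_n:\ \exists\sigma\in S_n,\ (\sigma(e_{\pi(s)}))_{s=1}^t=\mathbf B_t\right\}.$$
   Context: $\ell\mid n$, $V=T=[n]$; $\mathrm{next}(j)=j+1$ if $j\not\equiv 0\pmod\ell$, else $j-\ell+1$; $e_v=(v,\mathrm{next}(v))$. $\boldsymbol\pi:T\to V$ and $\boldsymbol\sigma:V\to V$ are independent uniformly random permutations, $\mathbf b_t=\boldsymbol\sigma(e_{\boldsymbol\pi(t)})$ (applying $\boldsymbol\sigma$ to both endpoints), and $\mathbf B_t=(\mathbf b_s)_{s=1}^t$. $S_n$ is the set of permutations of $[n]$. -}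

module Defs where

open import Data.Nat using (ℕ; zero; suc; _∸_; _<_; _<?_; NonZero)
open import Data.Nat.DivMod using (_%_)
open import Data.Nat as ℕ using ()
open import Data.Fin using (Fin; toℕ; fromℕ<)
open import Data.List using (List; []; _∷_; map; concatMap; allFin; filter; length; take)
open import Data.List.Membership.Propositional using (_∈_)
open import Data.List.Relation.Unary.AllPairs using (AllPairs; allPairs?)
open import Data.List.Relation.Unary.Any using (any?)
import Data.List.Relation.Unary.Any
open import Data.Vec using (Vec; lookup; toList) renaming ([] to []ᵛ; _∷_ to _∷ᵛ_)
open import Data.Product using (_×_; _,_; Σ-syntax)
import Data.Product
open import Data.Product.Properties using (≡-dec)
open import Data.Fin.Properties using () renaming (_≟_ to _≟ᶠ_)
open import Data.List.Properties using () renaming (≡-dec to ≡-decᴸ)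
open import Relation.Nullary using (Dec; ¬_; yes; no)
open import Relation.Nullary.Decidable using (¬?)
open import Relation.Binary.PropositionalEquality using (_≡_)
open import Relation.Binary using (DecidableEquality)

-- Vertices/times [n] = {1,…,n} are represented 0-based by Fin n
-- (element i : Fin n stands for i+1 ∈ [n]).

-- next, 0-based: for 1-based j = i+1,
--   next(j) = j+1        if j ≢ 0 (mod ℓ)   ↦ 0-based  suc i
--   next(j) = j-ℓ+1      if j ≡ 0 (mod ℓ)   ↦ 0-based  suc i ∸ ℓ
nextℕ : (ℓ : ℕ) .{{_ : NonZero ℓ}} → ℕ → ℕ
nextℕ ℓ i with suc i % ℓ ℕ.≟ 0
... | yes _ = suc i ∸ ℓ
... | no  _ = suc i

-- Under the standing assumption ℓ ∣ n the
-- value nextℕ ℓ i is always < n for i < n, so the fallback branch is never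
-- used; it is only there to make the function total without a proof term.
next : (n ℓ : ℕ) .{{_ : NonZero ℓ}} → Fin n → Fin n
next n ℓ i with nextℕ ℓ (toℕ i) <? n
... | yes p = fromℕ< p
... | no  _ = i

Edge : ℕ → Set
Edge n = Fin n × Fin n

edge : (n ℓ : ℕ) .{{_ : NonZero ℓ}} → Fin n → Edge n
edge n ℓ v = v , next n ℓ v

Map : ℕ → Set
Map n = Vec (Fin n) n

app : ∀ {n} → Map n → Fin n → Fin n
app f i = lookup f i

allVecs : (n k : ℕ) → List (Vec (Fin n) k)
allVecs n zero = []ᵛ ∷ []
allVecs n (suc k) = concatMap (λ i → map (i ∷ᵛ_) (allVecs n k)) (allFin n)

-- f is a permutation (i.e. injective, equivalently bijective on Fin n)
IsPerm : ∀ {n} → Map n → Set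
IsPerm f = AllPairs (λ x y → ¬ x ≡ y) (toList f)

isPerm? : ∀ {n} (f : Map n) → Dec (IsPerm f)
isPerm? f = allPairs? (λ x y → ¬? (x ≟ᶠ y)) (toList f)

Sn : (n : ℕ) → List (Map n)
Sn n = filter isPerm? (allVecs n n)

applyEdge : ∀ {n} → Map n → Edge n → Edge n
applyEdge σ (a , b) = app σ a , app σ b

Bseq : (n ℓ : ℕ) .{{_ : NonZero ℓ}} → (t : ℕ) → Map n → Map n → List (Edge n)
Bseq n ℓ t π σ = map (λ s → applyEdge σ (edge n ℓ (app π s))) (take t (allFin n))

edgeSeq-≟ : ∀ {n} → DecidableEquality (List (Edge n))
edgeSeq-≟ = ≡-decᴸ (≡-dec _≟ᶠ_ _≟ᶠ_)

-- number of σ ∈ S_n with B_t(π, σ) = B   (so that the joint count of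
-- (π,σ) equals the sum of these over π ∈ S_n)
countσ : (n ℓ : ℕ) .{{_ : NonZero ℓ}} → (t : ℕ) → Map n → List (Edge n) → ℕ
countσ n ℓ t π B = length (filter (λ σ → edgeSeq-≟ (Bseq n ℓ t π σ) B) (Sn n))

countPairs : (n ℓ : ℕ) .{{_ : NonZero ℓ}} → (t : ℕ) → List (Edge n) → ℕ
countPairs n ℓ t B =
  length (filter (λ p → edgeSeq-≟ (Bseq n ℓ t (Data.Product.proj₁ p) (Data.Product.proj₂ p)) B)
                 (concatMap (λ π → map (π ,_) (Sn n)) (Sn n)))

InΠ : (n ℓ : ℕ) .{{_ : NonZero ℓ}} → (t : ℕ) → List (Edge n) → Map n → Set
InΠ n ℓ t B π = IsPerm π × Σ[ σ ∈ Map n ] (σ ∈ Sn n × Bseq n ℓ t π σ ≡ B)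

inΠ? : (n ℓ : ℕ) .{{_ : NonZero ℓ}} → (t : ℕ) → (B : List (Edge n)) → (π : Map n) → Dec (Data.List.Relation.Unary.Any.Any (λ σ → Bseq n ℓ t π σ ≡ B) (Sn n))
inΠ? n ℓ t B π = any? (λ σ → edgeSeq-≟ (Bseq n ℓ t π σ) B) (Sn n)

Πt : (n ℓ : ℕ) .{{_ : NonZero ℓ}} → (t : ℕ) → List (Edge n) → List (Map n)
Πt n ℓ t B = filter (inΠ? n ℓ t B) (Sn n)

module Submission where

open import Defs
open import Data.Nat using (ℕ; zero; suc; _+_; _*_; _≤_; _<_; z≤n; s≤s; NonZero)
open import Data.Nat.Properties using (≤-antisym; *-zeroʳ; *-suc; 1+n≰n)
open import Data.Nat.Divisibility using (_∣_)
open import Data.Nat.ListAction using (sum)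
open import Data.List as List using (List; []; _∷_; _++_; length; map; filter; concatMap; allFin; take; cartesianProductWith)
open import Data.List.Properties using (length-map; length-++; length-++-sucʳ; map-∘; map-cong; filter-++; filter-none)
open import Data.List.Membership.Propositional using (_∈_; find)
open import Data.List.Membership.Propositional.Properties using (∈-∃++; ∈-filter⁺; ∈-filter⁻; ∈-map⁻; ∈-allFin; ∈-cartesianProductWith⁺)
open import Data.List.Relation.Unary.Any using (Any; here; there)
import Data.List.Relation.Unary.All as All
open import Data.List.Relation.Unary.All.Properties using (¬Any⇒All¬)
open import Data.List.Relation.Unary.AllPairs using ([]; _∷_)
open import Data.List.Relation.Unary.Unique.Propositional using (Unique)
import Data.List.Relation.Unary.Unique.Propositional.Properties as Unique
open import Data.Vec using (Vec; lookup; toList; tabulate) renaming ([] to []ᵛ; _∷_ to _∷ᵛ_)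
import Data.Vec as Vec
open import Data.Vec.Membership.Propositional.Properties using (∈-lookup; ∈-toList⁺)
open import Data.Vec.Properties using (lookup-map; tabulate∘lookup; tabulate-cong; lookup∘tabulate; ∷-injective)
open import Data.Fin as Fin using (Fin; punchOut) renaming (_≟_ to _≟ᶠ_)
open import Data.Fin.Properties using (any?; punchOut-injective; injective⇒≤)
open import Data.Product using (∃; _×_; _,_; proj₁; proj₂)
open import Function using (_∘_)
open import Function.Definitions using (Injective)
open import Relation.Nullary using (¬_; yes; no)
open import Relation.Unary using (Decidable)
open import Relation.Binary.PropositionalEquality using (_≡_; _≢_; refl; sym; trans; cong; cong₂; subst; module ≡-Reasoning)
open import Data.Empty using (⊥-elim)

-- Given B_t = B, the weight of π is the number of σ with B_t(π, σ) = B.  Since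
-- B_t(π, ρ ∘ σ) = ρ(B_t(π, σ)), witnesses σ₀ for π and σ₁ for π' give an injection
-- σ ↦ σ ∘ σ₀⁻¹ ∘ σ₁ from the witnesses for π to those for π', and symmetrically;
-- so the weight is constant on Π_t and vanishes outside it.

injective⇒surjective : ∀ {n} (f : Fin n → Fin n) → Injective _≡_ _≡_ f → ∀ y → ∃ λ x → f x ≡ y
injective⇒surjective {zero} f inj ()
injective⇒surjective {suc m} f inj y with any? (λ x → f x ≟ᶠ y)
... | yes hit = hit
... | no miss = ⊥-elim (1+n≰n (injective⇒≤ punchOut-y-injective))
  where
    y≢f : ∀ x → y ≢ f x
    y≢f x e = miss (x , sym e)
    punchOut-y-injective : Injective _≡_ _≡_ (λ x → punchOut (y≢f x))
    punchOut-y-injective {a} {b} e = inj (punchOut-injective (y≢f a) (y≢f b) e)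

toList≡tabulate-lookup : ∀ {A : Set} {k} (v : Vec A k) → toList v ≡ List.tabulate (lookup v)
toList≡tabulate-lookup []ᵛ = refl
toList≡tabulate-lookup (x ∷ᵛ xs) = cong (x ∷_) (toList≡tabulate-lookup xs)

unique-toList⁺ : ∀ {A : Set} {k} (v : Vec A k) → Injective _≡_ _≡_ (lookup v) → Unique (toList v)
unique-toList⁺ v inj = subst Unique (sym (toList≡tabulate-lookup v)) (Unique.tabulate⁺ inj)

unique-toList⁻ : ∀ {A : Set} {k} (v : Vec A k) → Unique (toList v) → Injective _≡_ _≡_ (lookup v)
unique-toList⁻ (x ∷ᵛ xs) (_ ∷ _) {Fin.zero} {Fin.zero} _ = refl
unique-toList⁻ (x ∷ᵛ xs) (x∉xs ∷ _) {Fin.zero} {Fin.suc j} e =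
  ⊥-elim (All.lookup x∉xs (∈-toList⁺ (∈-lookup j xs)) e)
unique-toList⁻ (x ∷ᵛ xs) (x∉xs ∷ _) {Fin.suc i} {Fin.zero} e =
  ⊥-elim (All.lookup x∉xs (∈-toList⁺ (∈-lookup i xs)) (sym e))
unique-toList⁻ (x ∷ᵛ xs) (_ ∷ xs-unique) {Fin.suc i} {Fin.suc j} e =
  cong Fin.suc (unique-toList⁻ xs xs-unique e)

lookup-extensional : ∀ {A : Set} {k} {u v : Vec A k} → (∀ i → lookup u i ≡ lookup v i) → u ≡ v
lookup-extensional {u = u} {v} u≗v =
  trans (sym (tabulate∘lookup u)) (trans (tabulate-cong u≗v) (tabulate∘lookup v))

infixr 9 _∘ₘ_

_∘ₘ_ : ∀ {n} → Map n → Map n → Map n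
f ∘ₘ g = Vec.map (app f) g

app-∘ₘ : ∀ {n} (f g : Map n) i → app (f ∘ₘ g) i ≡ app f (app g i)
app-∘ₘ f g i = lookup-map i (app f) g

∘ₘ-isPerm : ∀ {n} {f g : Map n} → IsPerm f → IsPerm g → IsPerm (f ∘ₘ g)
∘ₘ-isPerm {f = f} {g} f-perm g-perm = unique-toList⁺ (f ∘ₘ g) λ {i} {j} e →
  unique-toList⁻ g g-perm (unique-toList⁻ f f-perm
    (trans (sym (app-∘ₘ f g i)) (trans e (app-∘ₘ f g j))))

∘ₘ-cancel : ∀ {n} (σ g h : Map n) → (∀ x → app g (app h x) ≡ x) → (σ ∘ₘ g) ∘ₘ h ≡ σ
∘ₘ-cancel σ g h gh≗id = lookup-extensional λ x → begin
  app ((σ ∘ₘ g) ∘ₘ h) x    ≡⟨ app-∘ₘ (σ ∘ₘ g) h x ⟩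
  app (σ ∘ₘ g) (app h x)   ≡⟨ app-∘ₘ σ g (app h x) ⟩
  app σ (app g (app h x))  ≡⟨ cong (app σ) (gh≗id x) ⟩
  app σ x                  ∎
  where open ≡-Reasoning

∘ₘ-cancelʳ : ∀ {n} {a b g : Map n} (h : Map n) → (∀ x → app g (app h x) ≡ x) →
  a ∘ₘ g ≡ b ∘ₘ g → a ≡ b
∘ₘ-cancelʳ {a = a} {b} {g} h gh≗id e = begin
  a                ≡⟨ sym (∘ₘ-cancel a g h gh≗id) ⟩
  (a ∘ₘ g) ∘ₘ h    ≡⟨ cong (_∘ₘ h) e ⟩
  (b ∘ₘ g) ∘ₘ h    ≡⟨ ∘ₘ-cancel b g h gh≗id ⟩
  b                ∎
  where open ≡-Reasoning

module _ {n} (f : Map n) (f-perm : IsPerm f) where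

  private
    preimage : ∀ y → ∃ λ x → app f x ≡ y
    preimage = injective⇒surjective (app f) (unique-toList⁻ f f-perm)

  inverse : Map n
  inverse = tabulate (proj₁ ∘ preimage)

  inverseʳ : ∀ y → app f (app inverse y) ≡ y
  inverseʳ y = trans (cong (app f) (lookup∘tabulate (proj₁ ∘ preimage) y)) (proj₂ (preimage y))

  inverseˡ : ∀ x → app inverse (app f x) ≡ x
  inverseˡ x = unique-toList⁻ f f-perm (inverseʳ (app f x))

  inverse-isPerm : IsPerm inverse
  inverse-isPerm = unique-toList⁺ inverse λ {i} {j} e →
    trans (sym (inverseʳ i)) (trans (cong (app f) e) (inverseʳ j))

concatMap-map≡cartesianProductWith : ∀ {A B C : Set} (g : A → B → C) xs ys →
  concatMap (λ x → map (g x) ys) xs ≡ cartesianProductWith g xs ys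
concatMap-map≡cartesianProductWith g [] ys = refl
concatMap-map≡cartesianProductWith g (x ∷ xs) ys =
  cong (map (g x) ys ++_) (concatMap-map≡cartesianProductWith g xs ys)

allVecs-unique : ∀ n k → Unique (allVecs n k)
allVecs-unique n zero = All.[] ∷ []
allVecs-unique n (suc k) =
  subst Unique (sym (concatMap-map≡cartesianProductWith _∷ᵛ_ (allFin n) (allVecs n k)))
    (Unique.cartesianProductWith⁺ _∷ᵛ_ ∷-injective (Unique.allFin⁺ n) (allVecs-unique n k))

∈-allVecs : ∀ {n k} (v : Vec (Fin n) k) → v ∈ allVecs n k
∈-allVecs []ᵛ = here refl
∈-allVecs {n} {suc k} (x ∷ᵛ xs) =
  subst ((x ∷ᵛ xs) ∈_) (sym (concatMap-map≡cartesianProductWith _∷ᵛ_ (allFin n) (allVecs n k)))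
    (∈-cartesianProductWith⁺ _∷ᵛ_ (∈-allFin x) (∈-allVecs xs))

Sn-unique : ∀ n → Unique (Sn n)
Sn-unique n = Unique.filter⁺ isPerm? (allVecs-unique n n)

∈-Sn⁺ : ∀ {n} {σ : Map n} → IsPerm σ → σ ∈ Sn n
∈-Sn⁺ {σ = σ} = ∈-filter⁺ isPerm? (∈-allVecs σ)

∈-Sn⁻ : ∀ {n} {σ : Map n} → σ ∈ Sn n → IsPerm σ
∈-Sn⁻ {n} σ∈Sn = proj₂ (∈-filter⁻ isPerm? {xs = allVecs n n} σ∈Sn)

∈-++-∷⁻ : ∀ {A : Set} {x y : A} (as bs : List A) → y ∈ as ++ x ∷ bs → y ≢ x → y ∈ as ++ bs
∈-++-∷⁻ []       bs (here y≡x) y≢x = ⊥-elim (y≢x y≡x)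
∈-++-∷⁻ []       bs (there y∈bs) _ = y∈bs
∈-++-∷⁻ (a ∷ as) bs (here y≡a) _   = here y≡a
∈-++-∷⁻ (a ∷ as) bs (there y∈) y≢x = there (∈-++-∷⁻ as bs y∈ y≢x)

length-mono-⊆ : ∀ {A : Set} {xs ys : List A} → Unique xs → (∀ {z} → z ∈ xs → z ∈ ys) →
  length xs ≤ length ys
length-mono-⊆ {xs = []} _ _ = z≤n
length-mono-⊆ {xs = x ∷ xs} (x∉xs ∷ xs-unique) xs⊆ys with ∈-∃++ (xs⊆ys (here refl))
... | as , bs , refl = subst (suc (length xs) ≤_) (sym (length-++-sucʳ as x bs))
  (s≤s (length-mono-⊆ xs-unique λ z∈xs →
    ∈-++-∷⁻ as bs (xs⊆ys (there z∈xs)) (λ z≡x → All.lookup x∉xs z∈xs (sym z≡x))))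

length-filter-≤-injection : ∀ {A : Set} {P Q : A → Set} (P? : Decidable P) (Q? : Decidable Q)
  {xs : List A} → Unique xs → (f : A → A) → Injective _≡_ _≡_ f →
  (∀ {a} → a ∈ xs → P a → f a ∈ xs × Q (f a)) →
  length (filter P? xs) ≤ length (filter Q? xs)
length-filter-≤-injection P? Q? {xs} xs-unique f f-injective f-maps =
  subst (_≤ length (filter Q? xs)) (length-map f (filter P? xs))
    (length-mono-⊆ (Unique.map⁺ f-injective (Unique.filter⁺ P? xs-unique)) image⊆)
  where
    image⊆ : ∀ {z} → z ∈ map f (filter P? xs) → z ∈ filter Q? xs
    image⊆ z∈ with a , a∈ , refl ← ∈-map⁻ f z∈ with a∈xs , pa ← ∈-filter⁻ P? a∈
      = ∈-filter⁺ Q? (proj₁ (f-maps a∈xs pa)) (proj₂ (f-maps a∈xs pa))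

length-filter-map : ∀ {A B : Set} {P : B → Set} (P? : Decidable P) (g : A → B) (xs : List A) →
  length (filter P? (map g xs)) ≡ length (filter (P? ∘ g) xs)
length-filter-map P? g [] = refl
length-filter-map P? g (x ∷ xs) with P? (g x)
... | yes _ = cong suc (length-filter-map P? g xs)
... | no  _ = length-filter-map P? g xs

length-filter-pairs : ∀ {A B : Set} {P : A × B → Set} (P? : Decidable P) (xs : List A) (ys : List B) →
  length (filter P? (concatMap (λ a → map (a ,_) ys) xs))
    ≡ sum (map (λ a → length (filter (λ b → P? (a , b)) ys)) xs)
length-filter-pairs P? [] ys = refl
length-filter-pairs {A} {B} P? (x ∷ xs) ys = begin
  length (filter P? (map (x ,_) ys ++ pairsFrom xs))
    ≡⟨ cong length (filter-++ P? (map (x ,_) ys) (pairsFrom xs)) ⟩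
  length (filter P? (map (x ,_) ys) ++ filter P? (pairsFrom xs))
    ≡⟨ length-++ (filter P? (map (x ,_) ys)) ⟩
  length (filter P? (map (x ,_) ys)) + length (filter P? (pairsFrom xs))
    ≡⟨ cong₂ _+_ (length-filter-map P? (x ,_) ys) (length-filter-pairs P? xs ys) ⟩
  length (filter (λ b → P? (x , b)) ys) + sum (map (λ a → length (filter (λ b → P? (a , b)) ys)) xs)
    ∎
  where
    open ≡-Reasoning
    pairsFrom : List A → List (A × B)
    pairsFrom as = concatMap (λ a → map (a ,_) ys) as

sum-map-indicator : ∀ {A : Set} {Q : A → Set} (Q? : Decidable Q) (c : A → ℕ) (c₀ : ℕ) (xs : List A) →
  (∀ {x} → x ∈ xs → Q x → c x ≡ c₀) → (∀ {x} → x ∈ xs → ¬ Q x → c x ≡ 0) →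
  sum (map c xs) ≡ c₀ * length (filter Q? xs)
sum-map-indicator Q? c c₀ [] _ _ = sym (*-zeroʳ c₀)
sum-map-indicator Q? c c₀ (x ∷ xs) on off with Q? x
... | yes qx = trans (cong₂ _+_ (on (here refl) qx) (sum-map-indicator Q? c c₀ xs (on ∘ there) (off ∘ there)))
                   (sym (*-suc c₀ _))
... | no ¬qx = cong₂ _+_ (off (here refl) ¬qx) (sum-map-indicator Q? c c₀ xs (on ∘ there) (off ∘ there))

applyEdge-∘ₘ : ∀ {n} (f g : Map n) (e : Edge n) → applyEdge (f ∘ₘ g) e ≡ applyEdge f (applyEdge g e)
applyEdge-∘ₘ f g (a , b) = cong₂ _,_ (app-∘ₘ f g a) (app-∘ₘ f g b)

module _ (n ℓ : ℕ) .{{_ : NonZero ℓ}} (t : ℕ) where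

  Bseq-∘ₘ : ∀ (π f g : Map n) → Bseq n ℓ t π (f ∘ₘ g) ≡ map (applyEdge f) (Bseq n ℓ t π g)
  Bseq-∘ₘ π f g = begin
    map (λ s → applyEdge (f ∘ₘ g) (edgeAt s)) (take t (allFin n))
      ≡⟨ map-cong (λ s → applyEdge-∘ₘ f g (edgeAt s)) (take t (allFin n)) ⟩
    map (applyEdge f ∘ (λ s → applyEdge g (edgeAt s))) (take t (allFin n))
      ≡⟨ map-∘ (take t (allFin n)) ⟩
    map (applyEdge f) (Bseq n ℓ t π g)
      ∎
    where
      open ≡-Reasoning
      edgeAt : Fin n → Edge n
      edgeAt s = edge n ℓ (app π s)

  Bseq-transport : ∀ {π π' σ₀ σ₁ : Map n} (σ₀-perm : IsPerm σ₀) →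
    Bseq n ℓ t π' σ₁ ≡ Bseq n ℓ t π σ₀ →
    ∀ σ → Bseq n ℓ t π' ((σ ∘ₘ inverse σ₀ σ₀-perm) ∘ₘ σ₁) ≡ Bseq n ℓ t π σ
  Bseq-transport {π} {π'} {σ₀} {σ₁} σ₀-perm same-B σ = begin
    Bseq n ℓ t π' (ρ ∘ₘ σ₁)              ≡⟨ Bseq-∘ₘ π' ρ σ₁ ⟩
    map (applyEdge ρ) (Bseq n ℓ t π' σ₁) ≡⟨ cong (map (applyEdge ρ)) same-B ⟩
    map (applyEdge ρ) (Bseq n ℓ t π σ₀)  ≡⟨ sym (Bseq-∘ₘ π ρ σ₀) ⟩
    Bseq n ℓ t π (ρ ∘ₘ σ₀)               ≡⟨ cong (Bseq n ℓ t π) ρσ₀≡σ ⟩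
    Bseq n ℓ t π σ                       ∎
    where
      open ≡-Reasoning
      ρ : Map n
      ρ = σ ∘ₘ inverse σ₀ σ₀-perm
      ρσ₀≡σ : ρ ∘ₘ σ₀ ≡ σ
      ρσ₀≡σ = ∘ₘ-cancel σ (inverse σ₀ σ₀-perm) σ₀ (inverseˡ σ₀ σ₀-perm)

  countσ-mono : ∀ {π π' σ₀ σ₁ : Map n} {B : List (Edge n)} → IsPerm σ₀ → IsPerm σ₁ →
    Bseq n ℓ t π σ₀ ≡ B → Bseq n ℓ t π' σ₁ ≡ B → countσ n ℓ t π B ≤ countσ n ℓ t π' B
  countσ-mono {π} {π'} {σ₀} {σ₁} {B} σ₀-perm σ₁-perm B₀ B₁ =
    length-filter-≤-injection (λ σ → edgeSeq-≟ (Bseq n ℓ t π σ) B) (λ σ → edgeSeq-≟ (Bseq n ℓ t π' σ) B)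
      (Sn-unique n) shift shift-injective shift-maps
    where
      shift : Map n → Map n
      shift σ = (σ ∘ₘ inverse σ₀ σ₀-perm) ∘ₘ σ₁
      shift-injective : Injective _≡_ _≡_ shift
      shift-injective {a} {b} =
        ∘ₘ-cancelʳ {a = a} {b} {inverse σ₀ σ₀-perm} σ₀ (inverseˡ σ₀ σ₀-perm)
        ∘ ∘ₘ-cancelʳ {a = a ∘ₘ inverse σ₀ σ₀-perm} {b ∘ₘ inverse σ₀ σ₀-perm} {σ₁}
            (inverse σ₁ σ₁-perm) (inverseʳ σ₁ σ₁-perm)
      shift-maps : ∀ {σ} → σ ∈ Sn n → Bseq n ℓ t π σ ≡ B → shift σ ∈ Sn n × Bseq n ℓ t π' (shift σ) ≡ B
      shift-maps {σ} σ∈Sn Bσ =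
        ∈-Sn⁺ (∘ₘ-isPerm (∘ₘ-isPerm (∈-Sn⁻ σ∈Sn) (inverse-isPerm σ₀ σ₀-perm)) σ₁-perm) ,
        trans (Bseq-transport {π} {π'} {σ₀} {σ₁} σ₀-perm (trans B₁ (sym B₀)) σ) Bσ

  countσ-zero : ∀ {π : Map n} {B : List (Edge n)} → ¬ Any (λ σ → Bseq n ℓ t π σ ≡ B) (Sn n) →
    countσ n ℓ t π B ≡ 0
  countσ-zero {π} {B} no-σ =
    cong length (filter-none (λ σ → edgeSeq-≟ (Bseq n ℓ t π σ) B) (¬Any⇒All¬ (Sn n) no-σ))

  countPairs≡sum-countσ : ∀ B → countPairs n ℓ t B ≡ sum (map (λ π → countσ n ℓ t π B) (Sn n))
  countPairs≡sum-countσ B =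
    length-filter-pairs (λ p → edgeSeq-≟ (Bseq n ℓ t (proj₁ p) (proj₂ p)) B) (Sn n) (Sn n)

  countσ-constant-on-Πt : ∀ {π π' : Map n} {B : List (Edge n)} → InΠ n ℓ t B π →
    Any (λ σ → Bseq n ℓ t π' σ ≡ B) (Sn n) → countσ n ℓ t π' B ≡ countσ n ℓ t π B
  countσ-constant-on-Πt {π} {π'} {B} (_ , σ₀ , σ₀∈Sn , B₀) some-σ with σ₁ , σ₁∈Sn , B₁ ← find some-σ =
    ≤-antisym (countσ-mono {π'} {π} {σ₁} {σ₀} {B} (∈-Sn⁻ σ₁∈Sn) (∈-Sn⁻ σ₀∈Sn) B₁ B₀)
              (countσ-mono {π} {π'} {σ₀} {σ₁} {B} (∈-Sn⁻ σ₀∈Sn) (∈-Sn⁻ σ₁∈Sn) B₀ B₁)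

mainTheorem11 : (n ℓ : ℕ) .{{_ : NonZero ℓ}} → ℓ ∣ n →
    (t : ℕ) → 1 ≤ t → t ≤ n →
    (B : List (Edge n)) → 0 < countPairs n ℓ t B →
    (π₀ : Map n) → IsPerm π₀ →
      (InΠ n ℓ t B π₀ → countσ n ℓ t π₀ B * length (Πt n ℓ t B) ≡ countPairs n ℓ t B)
      × (¬ InΠ n ℓ t B π₀ → countσ n ℓ t π₀ B ≡ 0)
mainTheorem11 n ℓ _ t _ _ B _ π₀ π₀-perm = uniform , vanishing
  where
    uniform : InΠ n ℓ t B π₀ → countσ n ℓ t π₀ B * length (Πt n ℓ t B) ≡ countPairs n ℓ t B
    uniform π₀∈Πt = sym (trans (countPairs≡sum-countσ n ℓ t B)
      (sum-map-indicator (inΠ? n ℓ t B) (λ π → countσ n ℓ t π B) (countσ n ℓ t π₀ B) (Sn n)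
        (λ {π} _ → countσ-constant-on-Πt n ℓ t {π₀} {π} {B} π₀∈Πt)
        (λ {π} _ → countσ-zero n ℓ t {π} {B})))
    vanishing : ¬ InΠ n ℓ t B π₀ → countσ n ℓ t π₀ B ≡ 0
    vanishing π₀∉Πt = countσ-zero n ℓ t {π₀} {B} λ some-σ →
      let σ , σ∈Sn , Bσ = find some-σ in π₀∉Πt (π₀-perm , σ , σ∈Sn , Bσ)
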